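{- Suppose $\Phi\subseteq\{I,O,U\}$ and let $(\mathcal{R},\mathcal{T},\mathcal{A})$ be a knowledge base in $\mathcal{L}_\Phi$ such that if $O\notin\Phi$ then $\mathcal{A}$ contains only assertions of the form $C(a)$. Let $\mathcal{I}_0$ and $\mathcal{I}_1$ be unreachable-objects-free interpretations (w.r.t. $\mathcal{L}_\Phi$) such that $\mathcal{I}_0$ is a model of $\mathcal{R}$ and there is an $\mathcal{L}_\Phi$-bisimulation $Z$ between $\mathcal{I}_0$ and $\mathcal{I}_1$. Let $\mathcal{I}_1'$ be the least r-extension of $\mathcal{I}_1$ validating $\mathcal{R}$. Then: (1) $\mathcal{I}_1'$ is a model of $(\mathcal{R},\mathcal{T},\mathcal{A})$ iff $\mathcal{I}_0$ is a model of $(\mathcal{R},\mathcal{T},\mathcal{A})$; (2) $Z$ is an $\mathcal{L}_\Phi$-bisimulation between $\mathcal{I}_0$ and $\mathcal{I}_1'$.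
   Context: Fix finite sets $\Sigma_C,\Sigma_R,\Sigma_I$ of concept, role and individual names. Roles/concepts of $\mathcal{L}_\Phi$ ($\Phi\subseteq\{I,O,U\}$): $r\in\Sigma_R$ roles, $A\in\Sigma_C$ concepts; closed under role constructors $\varepsilon, R\circ S, R\sqcup S, R^*, C?$ and concept constructors $\top,\bot,\neg C,C\sqcap D,C\sqcup D,\forall R.C,\exists R.C$; plus $R^-$ if $I\in\Phi$; $\{a\}$ ($a\in\Sigma_I$) if $O\in\Phi$; role $U$ if $U\in\Phi$. Standard semantics: composition, union, reflexive-transitive closure, $(C?)^{\mathcal{I}}=\{(x,x):x\in C^{\mathcal{I}}\}$, $\varepsilon^{\mathcal{I}}$ identity, $U^{\mathcal{I}}=(\Delta^{\mathcal{I}})^2$, inverse, Booleans, $\{a\}^{\mathcal{I}}=\{a^{\mathcal{I}}\}$, $\forall,\exists$ as usual. Basic roles: elements of $\Sigma_R\cup\{r^-:r\in\Sigma_R\}$ if $I\in\Phi$, of $\Sigma_R$ otherwise. RBox: finite set of role axioms $\varepsilon\sqsubseteq r$ or $R_1\circ\dots\circ R_k\sqsubseteq r$ ($k\ge1$, $R_i$ basic), valid iff $\varepsilon^{\mathcal{I}}\subseteq r^{\mathcal{I}}$ resp. $R_1^{\mathcal{I}}\circ\dots\circ R_k^{\mathcal{I}}\subseteq r^{\mathcal{I}}$. TBox: finite set of $C\sqsubseteq D$, valid iff $C^{\mathcal{I}}\subseteq D^{\mathcal{I}}$. ABox: finite set of assertions $C(a)$, $R(a,b)$, $\neg R(a,b)$,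 $a=b$, $a\not\doteq b$ with the obvious satisfaction. A model of $(\mathcal{R},\mathcal{T},\mathcal{A})$ is a model of all three. $\mathcal{I}$ is unreachable-objects-free if every element is reachable from some $a^{\mathcal{I}}$ ($a\in\Sigma_I$) by a finite path of edges in $R^{\mathcal{I}}$ for basic roles $R$. $\mathcal{I}'$ is an r-extension of $\mathcal{I}$ if same domain, same interpretation of concept and individual names, and $r^{\mathcal{I}'}\supseteq r^{\mathcal{I}}$ for all $r\in\Sigma_R$; the least r-extension validating $\mathcal{R}$ is the unique r-extension that is a model of $\mathcal{R}$ and whose role relations are contained in those of every r-extension that is a model of $\mathcal{R}$. $Z\subseteq\Delta^{\mathcal{I}}\times\Delta^{\mathcal{I}'}$ is an $\mathcal{L}_\Phi$-bisimulation if for all $a,A,r$, $x,y\in\Delta^{\mathcal{I}}$, $x',y'\in\Delta^{\mathcal{I}'}$: (B1) $Z(a^{\mathcal{I}},a^{\mathcal{I}'})$; (B2) $Z(x,x')\Rightarrow(x\in A^{\mathcal{I}}\iff x'\in A^{\mathcal{I}'})$; (B3) $Z(x,x')\wedge(x,y)\in r^{\mathcal{I}}\Rightarrow\exists y'(Z(y,y')\wedge(x',y')\in r^{\mathcal{I}'})$; (B4) $Z(x,x')\wedge(x',y')\in r^{\mathcal{I}'}\Rightarrow\exists y(Z(y,y')\wedge(x,y)\in r^{\mathcal{I}})$; if $I\in\Phi$: (B5),(B6) analogous for predecessors; if $O\in\Phi$: (B7) $Z(x,x')\Rightarrow(x=a^{\mathcal{I}}\iff x'=a^{\mathcal{I}'})$;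 if $U\in\Phi$: (B10),(B11) $Z$ total on $\Delta^{\mathcal{I}}$ and surjective onto $\Delta^{\mathcal{I}'}$. -}

module Defs where

open import Data.Bool using (Bool; T)
open import Data.Nat using (ℕ)
open import Data.Fin using (Fin)
open import Data.List using (List; []; _∷_)
open import Data.List.NonEmpty using (List⁺; _∷_)
open import Data.List.Relation.Unary.All using (All)
open import Data.Product using (Σ; _×_; _,_; ∃)
open import Data.Sum using (_⊎_)
open import Data.Empty using (⊥)
open import Data.Unit using (⊤)
open import Relation.Nullary using (¬_)
open import Relation.Binary.PropositionalEquality using (_≡_)
open import Relation.Binary.Construct.Closure.ReflexiveTransitive using (Star)
open import Function.Bundles using (_⇔_)

record Lang : Set where
  field
    hasI hasO hasU : Bool
open Lang public

record Sig : Set where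
  field
    nC nR nI : ℕ
  CN : Set
  CN = Fin nC
  RN : Set
  RN = Fin nR
  IN : Set
  IN = Fin nI
open Sig public

Rel₂ : Set → Set₁
Rel₂ Δ = Δ → Δ → Set

module _ (S : Sig) where

  record Interp (Δ : Set) : Set₁ where
    field
      conc : CN S → Δ → Set
      role : RN S → Rel₂ Δ
      ind  : IN S → Δ
  open Interp public

  withRoles : {Δ : Set} → Interp Δ → (RN S → Rel₂ Δ) → Interp Δ
  withRoles I rr = record { conc = conc I ; role = rr ; ind = ind I }

module _ (S : Sig) (Φ : Lang) where

  mutual
    data Role : Set where
      rn    : RN S → Role
      eps   : Role
      _∘ᵣ_  : Role → Role → Role
      _⊔ᵣ_  : Role → Role → Role
      star  : Role → Role
      test  : Concept → Role
      inv   : T (hasI Φ) → Role → Role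
      univ  : T (hasU Φ) → Role

    data Concept : Set where
      cn   : CN S → Concept
      top  : Concept
      bot  : Concept
      neg  : Concept → Concept
      _⊓_  : Concept → Concept → Concept
      _⊔_  : Concept → Concept → Concept
      all  : Role → Concept → Concept
      ex   : Role → Concept → Concept
      nom  : T (hasO Φ) → IN S → Concept

  data BRole : Set where
    bn : RN S → BRole
    bi : T (hasI Φ) → RN S → BRole

  data RoleAxiom : Set where
    epsAx   : RN S → RoleAxiom
    chainAx : List⁺ BRole → RN S → RoleAxiom

  data Assertion : Set where
    cAs   : Concept → IN S → Assertion
    rAs   : Role → IN S → IN S → Assertion
    nrAs  : Role → IN S → IN S → Assertion
    eqAs  : IN S → IN S → Assertion
    neqAs : IN S → IN S → Assertion

  IsCAssertion : Assertion → Set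
  IsCAssertion (cAs _ _) = ⊤
  IsCAssertion (rAs _ _ _) = ⊥
  IsCAssertion (nrAs _ _ _) = ⊥
  IsCAssertion (eqAs _ _) = ⊥
  IsCAssertion (neqAs _ _) = ⊥

  record KB : Set where
    field
      rbox : List RoleAxiom
      tbox : List (Concept × Concept)     -- (C , D) stands for C ⊑ D
      abox : List Assertion
  open KB public

  module _ {Δ : Set} (I : Interp S Δ) where

    mutual
      ⟦_⟧R : Role → Rel₂ Δ
      ⟦ rn r ⟧R = role I r
      ⟦ eps ⟧R = _≡_
      ⟦ R ∘ᵣ R' ⟧R = λ x z → ∃ λ y → ⟦ R ⟧R x y × ⟦ R' ⟧R y z
      ⟦ R ⊔ᵣ R' ⟧R = λ x y → ⟦ R ⟧R x y ⊎ ⟦ R' ⟧R x y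
      ⟦ star R ⟧R = Star ⟦ R ⟧R
      ⟦ test C ⟧R = λ x y → x ≡ y × ⟦ C ⟧C x
      ⟦ inv _ R ⟧R = λ x y → ⟦ R ⟧R y x
      ⟦ univ _ ⟧R = λ _ _ → ⊤

      ⟦_⟧C : Concept → Δ → Set
      ⟦ cn A ⟧C = conc I A
      ⟦ top ⟧C = λ _ → ⊤
      ⟦ bot ⟧C = λ _ → ⊥
      ⟦ neg C ⟧C = λ x → ¬ ⟦ C ⟧C x
      ⟦ C ⊓ D ⟧C = λ x → ⟦ C ⟧C x × ⟦ D ⟧C x
      ⟦ C ⊔ D ⟧C = λ x → ⟦ C ⟧C x ⊎ ⟦ D ⟧C x
      ⟦ all R C ⟧C = λ x → ∀ y → ⟦ R ⟧R x y → ⟦ C ⟧C y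
      ⟦ ex R C ⟧C = λ x → ∃ λ y → ⟦ R ⟧R x y × ⟦ C ⟧C y
      ⟦ nom _ a ⟧C = λ x → x ≡ ind I a

    ⟦_⟧B : BRole → Rel₂ Δ
    ⟦ bn r ⟧B = role I r
    ⟦ bi _ r ⟧B = λ x y → role I r y x

    chainSem : BRole → List BRole → Rel₂ Δ
    chainSem R [] = ⟦ R ⟧B
    chainSem R (R' ∷ Rs) = λ x z → ∃ λ y → ⟦ R ⟧B x y × chainSem R' Rs y z

    SatRA : RoleAxiom → Set
    SatRA (epsAx r) = ∀ x y → x ≡ y → role I r x y
    SatRA (chainAx (R ∷ Rs) r) = ∀ x y → chainSem R Rs x y → role I r x y

    SatTA : Concept × Concept → Set
    SatTA (C , D) = ∀ x → ⟦ C ⟧C x → ⟦ D ⟧C x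

    SatAs : Assertion → Set
    SatAs (cAs C a) = ⟦ C ⟧C (ind I a)
    SatAs (rAs R a b) = ⟦ R ⟧R (ind I a) (ind I b)
    SatAs (nrAs R a b) = ¬ ⟦ R ⟧R (ind I a) (ind I b)
    SatAs (eqAs a b) = ind I a ≡ ind I b
    SatAs (neqAs a b) = ¬ (ind I a ≡ ind I b)

    ModelR : List RoleAxiom → Set
    ModelR = All SatRA

    ModelT : List (Concept × Concept) → Set
    ModelT = All SatTA

    ModelA : List Assertion → Set
    ModelA = All SatAs

    ModelKB : KB → Set
    ModelKB K = ModelR (rbox K) × ModelT (tbox K) × ModelA (abox K)

    Edge : Rel₂ Δ
    Edge x y = Σ BRole λ R → ⟦ R ⟧B x y

    UOFree : Set
    UOFree = ∀ x → Σ (IN S) λ a → Star Edge (ind I a) x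

  record IsLeastRExt {Δ : Set} (I : Interp S Δ) (Rb : List RoleAxiom)
                     (rr : RN S → Rel₂ Δ) : Set₁ where
    field
      extends : ∀ r x y → role I r x y → rr r x y
      valid   : ModelR (withRoles S I rr) Rb
      least   : (rr' : RN S → Rel₂ Δ) →
                (∀ r x y → role I r x y → rr' r x y) →
                ModelR (withRoles S I rr') Rb →
                ∀ r x y → rr r x y → rr' r x y

  record IsBisim {Δ Δ' : Set} (I : Interp S Δ) (I' : Interp S Δ')
                 (Z : Δ → Δ' → Set) : Set where
    field
      B1 : ∀ a → Z (ind I a) (ind I' a)
      B2 : ∀ A x x' → Z x x' → (conc I A x ⇔ conc I' A x')
      B3 : ∀ r x y x' → Z x x' → role I r x y →
           ∃ λ y' → Z y y' × role I' r x' y'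
      B4 : ∀ r x x' y' → Z x x' → role I' r x' y' →
           ∃ λ y → Z y y' × role I r x y
      B5 : T (hasI Φ) → ∀ r x y x' → Z x x' → role I r y x →
           ∃ λ y' → Z y y' × role I' r y' x'
      B6 : T (hasI Φ) → ∀ r x x' y' → Z x x' → role I' r y' x' →
           ∃ λ y → Z y y' × role I r y x
      B7 : T (hasO Φ) → ∀ a x x' → Z x x' → (x ≡ ind I a ⇔ x' ≡ ind I' a)
      B10 : T (hasU Φ) → ∀ x → ∃ λ x' → Z x x'
      B11 : T (hasU Φ) → ∀ x' → ∃ λ x → Z x x'

module Submission where

-- All reasoning is phrased with the "zig" condition
-- Zig Z P P' : every P-step from a Z-related point can be matched by a
-- P'-step ending in Z-related points.  Identity, composition, union and
-- reflexive-transitive closure preserve zig, and the converse flip Z of a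
-- bisimulation is again a bisimulation, so every "back" condition is the
-- "forth" condition of the converse and is never proved separately.
--
-- 1. Bisimulation invariance: concepts are preserved and complex roles
--    (and, with inverses, their converses) satisfy zig.
-- 2. For unreachable-objects-free interpretations a bisimulation is total
--    (walk along the basic-role path from a named individual); hence TBox
--    and ABox satisfaction transfer between bisimilar interpretations.
-- 3. The "Z-lift" of the roles of I₀ to Δ₁ extends I₁ and validates every
--    role axiom valid in I₀; by leastness it bounds the least r-extension,
--    which yields the back conditions for it, i.e. part (2).
-- Part (1) then follows from 2 applied to the bisimulation of part (2)
-- and to its converse.

open import Defs
open import Data.Bool using (T)
open import Data.List using ([]; _∷_)
open import Data.List.NonEmpty using (_∷_)
open import Data.List.Relation.Unary.All as All using (All; []; _∷_)
open import Data.Product using (_×_; _,_; ∃; proj₁; proj₂)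
open import Data.Sum using (_⊎_; inj₁; inj₂)
open import Data.Unit using (tt)
open import Function.Base using (flip; _∘_)
open import Function.Bundles using (_⇔_; mk⇔; Equivalence)
import Function.Properties.Equivalence as ⇔
open import Relation.Nullary using (¬_)
open import Relation.Nullary.Decidable using (T?; decidable-stable)
open import Relation.Binary.Core using (_⇒_)
open import Relation.Binary.PropositionalEquality using (_≡_; refl; subst)
open import Relation.Binary.Construct.Composition using (_;_)
open import Relation.Binary.Construct.Closure.ReflexiveTransitive
  using (Star; ε; _◅_; reverse)

Zig : {Δ Δ' : Set} → (Δ → Δ' → Set) → Rel₂ Δ → Rel₂ Δ' → Set
Zig Z P P' = ∀ {x x' y} → Z x x' → P x y → ∃ λ y' → Z y y' × P' x' y'

module _ {A : Set} (R S : Rel₂ A) where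

  converse-; : flip (R ; S) ⇒ (flip S ; flip R)
  converse-; (w , r , s) = w , s , r

  converse-;⁻¹ : (flip S ; flip R) ⇒ flip (R ; S)
  converse-;⁻¹ (w , s , r) = w , r , s

module _ {Δ Δ' : Set} {Z : Δ → Δ' → Set} where

  zig-⇒ : {P Q : Rel₂ Δ} {P' Q' : Rel₂ Δ'} →
          Q ⇒ P → P' ⇒ Q' → Zig Z P P' → Zig Z Q Q'
  zig-⇒ Q⇒P P'⇒Q' zig z q with zig z (Q⇒P q)
  ... | y' , zy , p' = y' , zy , P'⇒Q' p'

  zig-≡ : Zig Z _≡_ _≡_
  zig-≡ z refl = _ , z , refl

  zig-∘ : {P Q : Rel₂ Δ} {P' Q' : Rel₂ Δ'} →
          Zig Z P P' → Zig Z Q Q' → Zig Z (P ; Q) (P' ; Q')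
  zig-∘ zigP zigQ z (w , p , q) with zigP z p
  ... | w' , zw , p' with zigQ zw q
  ...   | y' , zy , q' = y' , zy , (w' , p' , q')

  zig-flip-∘ : {P Q : Rel₂ Δ} {P' Q' : Rel₂ Δ'} →
               Zig Z (flip P) (flip P') → Zig Z (flip Q) (flip Q') →
               Zig Z (flip (P ; Q)) (flip (P' ; Q'))
  zig-flip-∘ {P} {Q} {P'} {Q'} zigP zigQ =
    zig-⇒ (converse-; P Q) (converse-;⁻¹ P' Q') (zig-∘ zigQ zigP)

  zig-∪ : {P Q : Rel₂ Δ} {P' Q' : Rel₂ Δ'} → Zig Z P P' → Zig Z Q Q' →
          Zig Z (λ x y → P x y ⊎ Q x y) (λ x y → P' x y ⊎ Q' x y)
  zig-∪ zigP zigQ z (inj₁ p) with zigP z p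
  ... | y' , zy , p' = y' , zy , inj₁ p'
  zig-∪ zigP zigQ z (inj₂ q) with zigQ z q
  ... | y' , zy , q' = y' , zy , inj₂ q'

  zig-star : {P : Rel₂ Δ} {P' : Rel₂ Δ'} → Zig Z P P' → Zig Z (Star P) (Star P')
  zig-star zig z ε = _ , z , ε
  zig-star zig z (p ◅ ps) with zig z p
  ... | w' , zw , p' with zig-star zig zw ps
  ...   | y' , zy , ps' = y' , zy , (p' ◅ ps')

  zig-flip-star : {P : Rel₂ Δ} {P' : Rel₂ Δ'} →
                  Zig Z (flip P) (flip P') → Zig Z (flip (Star P)) (flip (Star P'))
  zig-flip-star zig = zig-⇒ (reverse (λ p → p)) (reverse (λ p → p)) (zig-star zig)

-- The Z-lift of a relation P on Δ to Δ': every Z-partner of x' has a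
-- P-successor that is a Z-partner of y'.  It is the largest relation on Δ'
-- satisfying the back condition with respect to P.
Lift : {Δ Δ' : Set} → (Δ → Δ' → Set) → Rel₂ Δ → Rel₂ Δ'
Lift Z P x' y' = ∀ x → Z x x' → ∃ λ y → Z y y' × P x y

module LiftProperties {Δ Δ' : Set} (Z : Δ → Δ' → Set) where

  lift-⇒ : {P Q : Rel₂ Δ} → P ⇒ Q → Lift Z P ⇒ Lift Z Q
  lift-⇒ P⇒Q lift x z with lift x z
  ... | y , zy , p = y , zy , P⇒Q p

  lift-refl : {P : Rel₂ Δ} → (∀ {x} → P x x) → ∀ {x'} → Lift Z P x' x'
  lift-refl P-refl x z = x , z , P-refl

  lift-∘ : {P Q : Rel₂ Δ} → (Lift Z P ; Lift Z Q) ⇒ Lift Z (P ; Q)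
  lift-∘ (w' , liftP , liftQ) x z with liftP x z
  ... | w , zw , p with liftQ w zw
  ...   | y , zy , q = y , zy , (w , p , q)

module _ (S : Sig) (Φ : Lang) where

  converse : {Δ Δ' : Set} {I : Interp S Δ} {I' : Interp S Δ'}
             {Z : Δ → Δ' → Set} →
             IsBisim S Φ I I' Z → IsBisim S Φ I' I (flip Z)
  converse B = record
    { B1 = B1
    ; B2 = λ A x' x z → ⇔.sym (B2 A x x' z)
    ; B3 = λ r x' y' x z p → B4 r x x' y' z p
    ; B4 = λ r x' x y z p → B3 r x y x' z p
    ; B5 = λ h r x' y' x z p → B6 h r x x' y' z p
    ; B6 = λ h r x' x y z p → B5 h r x y x' z p
    ; B7 = λ h a x' x z → ⇔.sym (B7 h a x x' z)
    ; B10 = B11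
    ; B11 = B10 }
    where open IsBisim B

  -- The
  -- back directions are the forth directions of the converse bisimulation.
  -- (In the union cases the points are passed explicitly: the two summands
  -- cannot be read off the union type at unknown points.)
  mutual
    concept-forth : {Δ Δ' : Set} {I : Interp S Δ} {I' : Interp S Δ'}
                    {Z : Δ → Δ' → Set} → IsBisim S Φ I I' Z →
                    ∀ C {x x'} → Z x x' → ⟦_⟧C S Φ I C x → ⟦_⟧C S Φ I' C x'
    concept-forth B (cn A) z c = Equivalence.to (IsBisim.B2 B A _ _ z) c
    concept-forth B top z _ = tt
    concept-forth B bot z ()
    concept-forth B (neg C) z ¬c c' = ¬c (concept-forth (converse B) C z c')
    concept-forth B (C ⊓ D) z (c , d) = concept-forth B C z c , concept-forth B D z d
    concept-forth B (C ⊔ D) z (inj₁ c) = inj₁ (concept-forth B C z c)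
    concept-forth B (C ⊔ D) z (inj₂ d) = inj₂ (concept-forth B D z d)
    concept-forth B (all R C) z ∀c y' r' with role-forth (converse B) R z r'
    ... | y , zy , r = concept-forth B C zy (∀c y r)
    concept-forth B (ex R C) z (y , r , c) with role-forth B R z r
    ... | y' , zy , r' = y' , r' , concept-forth B C zy c
    concept-forth B (nom h a) z e = Equivalence.to (IsBisim.B7 B h a _ _ z) e

    role-forth : {Δ Δ' : Set} {I : Interp S Δ} {I' : Interp S Δ'}
                 {Z : Δ → Δ' → Set} → IsBisim S Φ I I' Z →
                 ∀ R → Zig Z (⟦_⟧R S Φ I R) (⟦_⟧R S Φ I' R)
    role-forth B (rn r) z p = IsBisim.B3 B r _ _ _ z p
    role-forth B eps = zig-≡
    role-forth B (R ∘ᵣ R') = zig-∘ (role-forth B R) (role-forth B R')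
    role-forth B (R ⊔ᵣ R') {x} {x'} {y} =
      zig-∪ (role-forth B R) (role-forth B R') {x} {x'} {y}
    role-forth B (star R) = zig-star (role-forth B R)
    role-forth B (test C) z (refl , c) = _ , z , refl , concept-forth B C z c
    role-forth B (inv h R) = converse-role-forth h B R
    role-forth B (univ h) {y = y} z _ with IsBisim.B10 B h y
    ... | y' , zy = y' , zy , tt

    converse-role-forth : T (hasI Φ) →
                          {Δ Δ' : Set} {I : Interp S Δ} {I' : Interp S Δ'}
                          {Z : Δ → Δ' → Set} → IsBisim S Φ I I' Z →
                          ∀ R → Zig Z (flip (⟦_⟧R S Φ I R)) (flip (⟦_⟧R S Φ I' R))
    converse-role-forth h B (rn r) z p = IsBisim.B5 B h r _ _ _ z p
    converse-role-forth h B eps z refl = _ , z , refl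
    converse-role-forth h B (R ∘ᵣ R') =
      zig-flip-∘ (converse-role-forth h B R) (converse-role-forth h B R')
    converse-role-forth h B (R ⊔ᵣ R') {x} {x'} {y} =
      zig-∪ (converse-role-forth h B R) (converse-role-forth h B R') {x} {x'} {y}
    converse-role-forth h B (star R) = zig-flip-star (converse-role-forth h B R)
    converse-role-forth h B (test C) z (refl , c) = _ , z , refl , concept-forth B C z c
    converse-role-forth h B (inv _ R) = role-forth B R
    converse-role-forth h B (univ h') {y = y} z _ with IsBisim.B10 B h' y
    ... | y' , zy = y' , zy , tt

  module _ {Δ Δ' : Set} {I : Interp S Δ} {I' : Interp S Δ'}
           {Z : Δ → Δ' → Set} (B : IsBisim S Φ I I' Z) where
    open IsBisim B

    edge-forth : Zig Z (Edge S Φ I) (Edge S Φ I')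
    edge-forth z (bn r , p) with B3 r _ _ _ z p
    ... | y' , zy , p' = y' , zy , (bn r , p')
    edge-forth z (bi h r , p) with B5 h r _ _ _ z p
    ... | y' , zy , p' = y' , zy , (bi h r , p')

    -- On an unreachable-objects-free interpretation a bisimulation is total:
    -- follow the path from a named individual, which is related by B1.
    total : UOFree S Φ I → ∀ x → ∃ λ x' → Z x x'
    total uof x with uof x
    ... | a , path with zig-star edge-forth (B1 a) path
    ...   | x' , z , _ = x' , z

    tbox-forth : (∀ x' → ∃ λ x → Z x x') →
                 ∀ {ts} → ModelT S Φ I ts → ModelT S Φ I' ts
    tbox-forth onto = All.map (λ {ax} → axiom-forth {ax})
      where
      axiom-forth : ∀ {ax} → SatTA S Φ I ax → SatTA S Φ I' ax
      axiom-forth {C , D} C⊑D x' c' with onto x'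
      ... | x , z = concept-forth B D z (C⊑D x (concept-forth (converse B) C z c'))

    -- With nominals, a bisimulation relates exactly the interpretations of
    -- the same individual (B1 and B7), so role assertions and (in)equalities
    -- between individuals transfer.
    named-role-forth : T (hasO Φ) → ∀ R a b →
                       ⟦_⟧R S Φ I R (ind I a) (ind I b) →
                       ⟦_⟧R S Φ I' R (ind I' a) (ind I' b)
    named-role-forth h R a b p with role-forth B R (B1 a) p
    ... | y' , zy , p' =
      subst (⟦_⟧R S Φ I' R (ind I' a)) (Equivalence.to (B7 h b _ _ zy) refl) p'

    named-eq-forth : T (hasO Φ) → ∀ a b → ind I a ≡ ind I b → ind I' a ≡ ind I' b
    named-eq-forth h a b = Equivalence.to (B7 h b _ _ (B1 a))

  -- Assertions other than C(a) only occur when nominals are available.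
  nominals-available : ¬ ¬ T (hasO Φ) → T (hasO Φ)
  nominals-available = decidable-stable (T? (hasO Φ))

  assertion-forth : {Δ Δ' : Set} {I : Interp S Δ} {I' : Interp S Δ'}
                    {Z : Δ → Δ' → Set} → IsBisim S Φ I I' Z →
                    ∀ as → (¬ T (hasO Φ) → IsCAssertion S Φ as) →
                    SatAs S Φ I as → SatAs S Φ I' as
  assertion-forth B (cAs C a) _ c = concept-forth B C (IsBisim.B1 B a) c
  assertion-forth B (rAs R a b) onlyC p =
    named-role-forth B (nominals-available onlyC) R a b p
  assertion-forth B (nrAs R a b) onlyC ¬p p' =
    ¬p (named-role-forth (converse B) (nominals-available onlyC) R a b p')
  assertion-forth B (eqAs a b) onlyC e =
    named-eq-forth B (nominals-available onlyC) a b e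
  assertion-forth B (neqAs a b) onlyC ¬e e' =
    ¬e (named-eq-forth (converse B) (nominals-available onlyC) a b e')

  abox-forth : {Δ Δ' : Set} {I : Interp S Δ} {I' : Interp S Δ'}
               {Z : Δ → Δ' → Set} → IsBisim S Φ I I' Z →
               ∀ as → (¬ T (hasO Φ) → All (IsCAssertion S Φ) as) →
               ModelA S Φ I as → ModelA S Φ I' as
  abox-forth B [] _ [] = []
  abox-forth B (as ∷ ass) onlyC (p ∷ ps) =
    assertion-forth B as (All.head ∘ onlyC) p ∷ abox-forth B ass (All.tail ∘ onlyC) ps

  -- The lift of P together with, when inverses are available, the lift of
  -- its converse: the largest relation satisfying both back conditions.
  LiftΦ : {Δ Δ' : Set} → (Δ → Δ' → Set) → Rel₂ Δ → Rel₂ Δ'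
  LiftΦ Z P x' y' = Lift Z P x' y' × (T (hasI Φ) → Lift Z (flip P) y' x')

  module LiftΦProperties {Δ Δ' : Set} (Z : Δ → Δ' → Set) where
    open LiftProperties Z

    liftΦ-⇒ : {P Q : Rel₂ Δ} → P ⇒ Q → LiftΦ Z P ⇒ LiftΦ Z Q
    liftΦ-⇒ P⇒Q (lift , lift⁻) = lift-⇒ P⇒Q lift , λ h → lift-⇒ P⇒Q (lift⁻ h)

    liftΦ-refl : {P : Rel₂ Δ} → (∀ {x} → P x x) → ∀ {x'} → LiftΦ Z P x' x'
    liftΦ-refl P-refl = lift-refl P-refl , λ _ → lift-refl P-refl

    liftΦ-∘ : {P Q : Rel₂ Δ} → (LiftΦ Z P ; LiftΦ Z Q) ⇒ LiftΦ Z (P ; Q)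
    liftΦ-∘ {P} {Q} (w' , (liftP , liftP⁻) , (liftQ , liftQ⁻)) =
      lift-∘ (w' , liftP , liftQ) ,
      λ h → lift-⇒ (converse-;⁻¹ P Q) (lift-∘ (w' , liftQ⁻ h , liftP⁻ h))

  module _ {Δ₀ Δ₁ : Set} {I₀ : Interp S Δ₀} {I₁ : Interp S Δ₁}
           {Z : Δ₀ → Δ₁ → Set} (B : IsBisim S Φ I₀ I₁ Z) where
    open IsBisim B
    open LiftΦProperties Z

    lifted : RN S → Rel₂ Δ₁
    lifted r = LiftΦ Z (role I₀ r)

    Lifted : Interp S Δ₁
    Lifted = withRoles S I₁ lifted

    lifted-extends : ∀ r x' y' → role I₁ r x' y' → lifted r x' y'
    lifted-extends r x' y' p =
      (λ x z → B4 r x x' y' z p) , (λ h y z → B6 h r y y' x' z p)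

    basic-lifted : ∀ R → ⟦_⟧B S Φ Lifted R ⇒ LiftΦ Z (⟦_⟧B S Φ I₀ R)
    basic-lifted (bn r) p = p
    basic-lifted (bi h r) (lift , lift⁻) = lift⁻ h , λ _ → lift

    chain-lifted : ∀ R Rs → chainSem S Φ Lifted R Rs ⇒ LiftΦ Z (chainSem S Φ I₀ R Rs)
    chain-lifted R [] = basic-lifted R
    chain-lifted R (R' ∷ Rs) (w' , p , ps) =
      liftΦ-∘ (w' , basic-lifted R p , chain-lifted R' Rs ps)

    lifted-validates : ∀ {ax} → SatRA S Φ I₀ ax → SatRA S Φ Lifted ax
    lifted-validates {epsAx r} ε⊑r x' .x' refl = liftΦ-refl (ε⊑r _ _ refl)
    lifted-validates {chainAx (R ∷ Rs) r} Rs⊑r x' y' p =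
      liftΦ-⇒ (λ {x} {y} → Rs⊑r x y) (chain-lifted R Rs p)

    -- Part (2): the least r-extension of I₁ validating an RBox valid in I₀
    -- is contained in the lifted roles, hence still satisfies B4 and B6;
    -- B3 and B5 hold as it extends I₁.
    least-extension-bisim : ∀ {Rb rr} → ModelR S Φ I₀ Rb →
                            IsLeastRExt S Φ I₁ Rb rr →
                            IsBisim S Φ I₀ (withRoles S I₁ rr) Z
    least-extension-bisim {rr = rr} valid₀ L = record
      { B1 = B1
      ; B2 = B2
      ; B3 = λ r x y x' z p →
               let (y' , zy , q) = B3 r x y x' z p in y' , zy , extends r x' y' q
      ; B4 = λ r x x' y' z p → proj₁ (below-lifted r x' y' p) x z
      ; B5 = λ h r x y x' z p →
               let (y' , zy , q) = B5 h r x y x' z p in y' , zy , extends r y' x' q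
      ; B6 = λ h r x x' y' z p → proj₂ (below-lifted r y' x' p) h x z
      ; B7 = B7
      ; B10 = B10
      ; B11 = B11 }
      where
      open IsLeastRExt L
      below-lifted : ∀ r x' y' → rr r x' y' → lifted r x' y'
      below-lifted = least lifted lifted-extends (All.map lifted-validates valid₀)

-- For part (1), both interpretations
-- satisfy the RBox (I₀ by hypothesis, the extension by construction), and
-- TBox and ABox satisfaction transfer along the bisimulation of part (2)
-- and its converse, which are surjective because I₀ and I₁ are
-- unreachable-objects-free.
theorem6 : (S : Sig) (Φ : Lang) (K : KB S Φ) →
           (¬ T (hasO Φ) → All (IsCAssertion S Φ) (KB.abox K)) →
           {Δ₀ Δ₁ : Set} (I₀ : Interp S Δ₀) (I₁ : Interp S Δ₁) →
           UOFree S Φ I₀ → UOFree S Φ I₁ →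
           ModelR S Φ I₀ (KB.rbox K) →
           (Z : Δ₀ → Δ₁ → Set) → IsBisim S Φ I₀ I₁ Z →
           (rr : RN S → Rel₂ Δ₁) → IsLeastRExt S Φ I₁ (KB.rbox K) rr →
           (ModelKB S Φ (withRoles S I₁ rr) K ⇔ ModelKB S Φ I₀ K)
           × IsBisim S Φ I₀ (withRoles S I₁ rr) Z
theorem6 S Φ K onlyC I₀ I₁ uof₀ uof₁ rbox₀ Z B rr L =
  mk⇔ (λ (_ , tbox , abox) →
         rbox₀ , tbox-forth S Φ B⁻¹ (total S Φ B uof₀) tbox ,
         abox-forth S Φ B⁻¹ (KB.abox K) onlyC abox)
      (λ (_ , tbox , abox) →
         IsLeastRExt.valid L , tbox-forth S Φ B' (total S Φ (converse S Φ B) uof₁) tbox ,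
         abox-forth S Φ B' (KB.abox K) onlyC abox)
  , B'
  where
  B' : IsBisim S Φ I₀ (withRoles S I₁ rr) Z
  B' = least-extension-bisim S Φ B rbox₀ L
  B⁻¹ : IsBisim S Φ (withRoles S I₁ rr) I₀ (flip Z)
  B⁻¹ = converse S Φ B'
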